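{- For every graph $G$, $r(G)\le \left\lfloor \frac{\Delta(G)}{2}\right\rfloor r_v(G)$ and $r(G)\le \left\lfloor \frac{\Delta(G)}{2}\right\rfloor r'_v(G)$; that is, $\frac{r(G)}{r_v(G)}\le \left\lfloor \frac{\Delta(G)}{2}\right\rfloor$ and $\frac{r(G)}{r'_v(G)}\le \left\lfloor \frac{\Delta(G)}{2}\right\rfloor$. Furthermore, these bounds are best possible: for every integer $\Delta\ge 2$ there is a graph $G$ with $\Delta(G)=\Delta$ and $\frac{r(G)}{r_v(G)}=\frac{r(G)}{r'_v(G)}=\left\lfloor \frac{\Delta}{2}\right\rfloor$.
   Context: Graphs are finite, connected, may have multiple edges but no loops. The resistance $r(G)$ is the minimum number of edges that have to be removed from $G$ to obtain a $\Delta(G)$-edge-colorable subgraph. A graph $H$ is class 1 if $\chi'(H)=\Delta(H)$, where $\chi'$ is the chromatic index. $r_v(G)$ is the minimum number of vertices that have to be removed from $G$ to obtain a class 1 graph, and $r'_v(G)$ is the minimum number of vertices that have to be removed from $G$ to obtain a graph $K$ with $\chi'(K)\le \Delta(G)$. -}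

module Defs where

open import Data.Bool using (Bool; true; false; not; _∧_; _∨_)
open import Data.Nat using (ℕ; zero; suc; _≤_; _⊔_; _∸_)
open import Data.Fin using (Fin; _≟_)
open import Data.Fin.Subset using (Subset; ∣_∣)
import Data.Vec as Vec
open import Data.List using (List; length; filterᵇ; allFin; map; foldr; lookup)
open import Data.List.Membership.Propositional using (_∈_)
open import Data.List.Relation.Unary.All using (All)
open import Data.List.Relation.Binary.Sublist.Propositional using (_⊆_)
open import Data.Product using (Σ; _×_; _,_; proj₁; proj₂; ∃; ∃-syntax)
open import Data.Sum using (_⊎_)
open import Relation.Nullary using (¬_; does)
open import Relation.Binary.PropositionalEquality using (_≡_; _≢_)

-- An edge over vertex set Fin n is an (unordered, by convention) pair of endpoints.
Edge : ℕ → Set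
Edge n = Fin n × Fin n

-- A finite multigraph: vertices Fin n, edges a list (so parallel edges allowed).
record Graph : Set where
  constructor graph
  field
    n     : ℕ
    edges : List (Edge n)
open Graph public

data Reach {n : ℕ} (es : List (Edge n)) : Fin n → Fin n → Set where
  here : ∀ {u} → Reach es u u
  step : ∀ {u w v} → ((u , w) ∈ es ⊎ (w , u) ∈ es) → Reach es w v → Reach es u v

Loopless : Graph → Set
Loopless G = All (λ e → proj₁ e ≢ proj₂ e) (edges G)

Connected : Graph → Set
Connected G = ∀ (u v : Fin (n G)) → Reach (edges G) u v

-- "graph" in the sense of the paper: finite, connected, loopless (multi-edges allowed)
IsGraph : Graph → Set
IsGraph G = Loopless G × Connected G

incident : ∀ {n} → Fin n → Edge n → Bool
incident v (a , b) = does (a ≟ v) ∨ does (b ≟ v)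

deg : ∀ {n} → List (Edge n) → Fin n → ℕ
deg es v = length (filterᵇ (incident v) es)

maxDeg : ∀ n → List (Edge n) → ℕ
maxDeg n es = foldr _⊔_ 0 (map (deg es) (allFin n))

Δ : Graph → ℕ
Δ G = maxDeg (n G) (edges G)

ShareEnd : ∀ {n} → Edge n → Edge n → Set
ShareEnd (a , b) (c , d) = a ≡ c ⊎ a ≡ d ⊎ b ≡ c ⊎ b ≡ d

Colorable : ∀ {n} → ℕ → List (Edge n) → Set
Colorable {n} k es =
  Σ (Fin (length es) → Fin k) λ c →
    ∀ (i j : Fin (length es)) → i ≢ j →
      ShareEnd (lookup es i) (lookup es j) → c i ≢ c j

IsChromaticIndex : ∀ {n} → List (Edge n) → ℕ → Set
IsChromaticIndex es k = Colorable k es × (∀ j → Colorable j es → k ≤ j)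

Class1 : ∀ n → List (Edge n) → Set
Class1 n es = IsChromaticIndex es (maxDeg n es)

IsResistance : Graph → ℕ → Set
IsResistance G r =
  (∃[ es' ] (es' ⊆ edges G × length (edges G) ∸ length es' ≡ r × Colorable (Δ G) es'))
  × (∀ es' → es' ⊆ edges G → Colorable (Δ G) es' → r ≤ length (edges G) ∸ length es')

delEdges : (G : Graph) → Subset (n G) → List (Edge (n G))
delEdges G S = filterᵇ (λ e → not (Vec.lookup S (proj₁ e)) ∧ not (Vec.lookup S (proj₂ e))) (edges G)

IsRv : Graph → ℕ → Set
IsRv G k =
  (∃[ S ] (∣ S ∣ ≡ k × Class1 (n G) (delEdges G S)))
  × (∀ S → Class1 (n G) (delEdges G S) → k ≤ ∣ S ∣)

IsRv' : Graph → ℕ → Set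
IsRv' G k =
  (∃[ S ] (∣ S ∣ ≡ k × Colorable (Δ G) (delEdges G S)))
  × (∀ S → Colorable (Δ G) (delEdges G S) → k ≤ ∣ S ∣)

-- Upper bound: let S be a set of vertices such that G − S is Δ-edge-colourable, and read that
-- colouring as a partial Δ-colouring of G. While some vertex v has more uncoloured than coloured
-- edges, one more edge can be coloured: a colour α is missing at v, and either an uncoloured edge vu
-- has a colour missing at both ends, or two uncoloured edges vu₁, vu₂ with u₁ ≠ u₂ share a colour β
-- missing at u₁ and u₂, and an αβ-Kempe interchange frees α at u₁ or u₂; otherwise every colour
-- missing at such a neighbour u is used at v, and only at one such u, which bounds the uncoloured
-- degree of v by its coloured degree. In the end at most ⌊Δ/2⌋ uncoloured edges meet each vertex,
-- and all of them meet S, so at most ⌊Δ/2⌋·|S| edges stay uncoloured.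
--
-- Sharpness: a triangle with ⌊Δ/2⌋, ⌊Δ/2⌋ and ⌈Δ/2⌉ parallel edges has maximum degree Δ; its edges
-- are pairwise adjacent, so a Δ-colourable subgraph has at most Δ of them, whence r = ⌊Δ/2⌋,
-- while deleting one vertex leaves ⌈Δ/2⌉ parallel edges, a class 1 graph.

module Submission where

open import Defs
open import Data.Bool using (Bool; true; false; not; _∧_; if_then_else_; T)
import Data.Bool as B
open import Data.Bool.Properties using (not-involutive; not-injective; ¬-not; ∨-zeroʳ)
open import Data.Empty using (⊥; ⊥-elim)
open import Data.Fin using (Fin; zero; suc; _≟_; toℕ; fromℕ<; inject≤)
import Data.Fin as F
open import Data.Fin.Permutation.Components using (transpose; transpose-inverse)
open import Data.Fin.Properties using (any?; pigeonhole; toℕ<n; toℕ-fromℕ<; suc-injective; inject≤-injective; injective⇒≤)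
open import Data.Fin.Subset using (Subset; ∣_∣)
open import Data.List using (List; []; _∷_; length; lookup; filterᵇ; foldr; map; allFin; replicate; _++_)
open import Data.List.Membership.Propositional using (_∈_)
open import Data.List.Membership.Propositional.Properties using (∈-allFin; ∈-lookup; ∈-++⁺ʳ)
open import Data.List.Properties using (length-replicate; length-++; filter-++; filter-all; filter-none)
open import Data.List.Relation.Binary.Sublist.Propositional using (_⊆_; []; _∷_; _∷ʳ_; ⊆-refl)
open import Data.List.Relation.Binary.Sublist.Propositional.Properties using (All-resp-⊆; ++⁺ˡ)
open import Data.List.Relation.Unary.All using (All)
import Data.List.Relation.Unary.All as All
open import Data.List.Relation.Unary.All.Properties using (replicate⁺; ++⁺)
open import Data.List.Relation.Unary.Any using (here; there)
open import Data.Maybe using (Maybe; just; nothing; is-just; is-nothing)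
import Data.Maybe as M
open import Data.Maybe.Properties using (just-injective; map-injective)
import Data.Maybe.Properties as MP
open import Data.Nat using (ℕ; zero; suc; _+_; _*_; _∸_; _≤_; _<_; z≤n; s≤s; _<?_; _⊔_; ⌊_/2⌋; ⌈_/2⌉)
open import Data.Nat.Induction using (<-wellFounded)
open import Data.Nat.Properties
  using ( ≤-refl; ≤-trans; ≤-reflexive; ≤-pred; <-≤-trans; <-irrefl; <⇒≱; ≮⇒≥; n≤0⇒n≡0; n≤1+n; n<1+n
        ; m≤n⇒m≤1+n; m≤n⇒m<n∨m≡n; m≤n+m; +-comm; +-suc; +-identityʳ; *-zeroʳ; *-identityʳ
        ; +-mono-≤; +-monoˡ-≤; +-monoʳ-≤; +-cancelʳ-≤; m+n∸m≡n; m+n∸n≡m; ∸-monoʳ-≤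
        ; m≤m⊔n; m≤n⊔m; ⊔-lub; ⊔-idem; ⊔-identityʳ; m≤n⇒m⊔n≡n
        ; n≡⌊n+n/2⌋; ⌊n/2⌋-mono; ⌊n/2⌋+⌈n/2⌉≡n; ⌊n/2⌋≤⌈n/2⌉; module ≤-Reasoning )
open import Algebra.Properties.Semiring.Sum Data.Nat.Properties.+-*-semiring
  using (sum; sum-syntax; sum-cong-≗; ∑-distrib-+; ∑-comm; *-distribˡ-sum; sum-replicate-zero)
open import Data.Product using (Σ; _×_; _,_; proj₁; proj₂; ∃; ∃-syntax)
open import Data.Product.Properties using (,-injectiveˡ; ,-injectiveʳ)
open import Data.Sum using (_⊎_; inj₁; inj₂; [_,_]′)
open import Data.Unit using (tt)
open import Data.Vec using ([]; _∷_)
import Data.Vec as Vec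
open import Function using (_∘_)
open import Induction.WellFounded using (Acc; acc)
open import Relation.Binary.PropositionalEquality
  using (_≡_; _≢_; refl; sym; trans; cong; cong₂; subst; subst₂; module ≡-Reasoning)
open import Relation.Nullary using (¬_; Dec; yes; no; does; ¬?)
open import Relation.Nullary.Decidable using (dec-true; dec-false; _×-dec_; T?)

from-does : ∀ {A : Set} (a? : Dec A) → does a? ≡ true → A
from-does (yes a) _ = a

∧-true⁻ : ∀ {a b} → a ∧ b ≡ true → a ≡ true × b ≡ true
∧-true⁻ {true} b≡true = refl , b≡true

∧-true⁺ : ∀ {a b} → a ≡ true → b ≡ true → a ∧ b ≡ true
∧-true⁺ refl refl = refl

boolToℕ : Bool → ℕ
boolToℕ true = 1
boolToℕ false = 0

count : ∀ {m} → (Fin m → Bool) → ℕ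
count {m} p = ∑[ i < m ] boolToℕ (p i)

sum-mono-≤ : ∀ {m} {f g : Fin m → ℕ} → (∀ i → f i ≤ g i) → sum f ≤ sum g
sum-mono-≤ {zero} _ = z≤n
sum-mono-≤ {suc m} f≤g = +-mono-≤ (f≤g zero) (sum-mono-≤ (f≤g ∘ suc))

count-false : ∀ m → count {m} (λ _ → false) ≡ 0
count-false m = sum-replicate-zero m

count-true : ∀ m → count {m} (λ _ → true) ≡ m
count-true zero = refl
count-true (suc m) = cong suc (count-true m)

count-mono : ∀ {m} {p q : Fin m → Bool} → (∀ i → p i ≡ true → q i ≡ true) → count p ≤ count q
count-mono {p = p} {q} p⇒q = sum-mono-≤ pointwise
  where
  pointwise : ∀ i → boolToℕ (p i) ≤ boolToℕ (q i)
  pointwise i with p i | p⇒q i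
  ... | false | _ = z≤n
  ... | true | pi⇒qi rewrite pi⇒qi refl = ≤-refl

count-none : ∀ {m} {p : Fin m → Bool} → (∀ i → p i ≢ true) → count p ≡ 0
count-none {m} ¬p = n≤0⇒n≡0 (≤-trans (count-mono (λ i pi → ⊥-elim (¬p i pi))) (≤-reflexive (count-false m)))

count-split : ∀ {m} (p q : Fin m → Bool) → count (λ i → p i ∧ q i) + count (λ i → p i ∧ not (q i)) ≡ count p
count-split p q =
  trans (sym (∑-distrib-+ (λ i → boolToℕ (p i ∧ q i)) (λ i → boolToℕ (p i ∧ not (q i))))) (sum-cong-≗ pointwise)
  where
  pointwise : ∀ i → boolToℕ (p i ∧ q i) + boolToℕ (p i ∧ not (q i)) ≡ boolToℕ (p i)
  pointwise i with p i | q i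
  ... | true | true = refl
  ... | true | false = refl
  ... | false | _ = refl

count-witness : ∀ {m} (p : Fin m → Bool) → 1 ≤ count p → ∃ λ i → p i ≡ true
count-witness {suc m} p pos with p zero in p0
... | true = zero , p0
... | false = let (i , pi) = count-witness (p ∘ suc) pos in suc i , pi

count-positive : ∀ {m} (p : Fin m → Bool) i → p i ≡ true → 1 ≤ count p
count-positive p zero pi rewrite pi = s≤s z≤n
count-positive p (suc i) pi = ≤-trans (count-positive (p ∘ suc) i pi) (m≤n+m _ (boolToℕ (p zero)))

count-remove : ∀ {m} (p : Fin m → Bool) t → p t ≡ true →
               count p ≡ suc (count (λ j → p j ∧ not (does (j ≟ t))))
count-remove p zero pt rewrite pt = cong suc (sum-cong-≗ pointwise)
  where
  pointwise : ∀ i → boolToℕ (p (suc i)) ≡ boolToℕ (p (suc i) ∧ true)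
  pointwise i with p (suc i)
  ... | true = refl
  ... | false = refl
count-remove p (suc t) pt with p zero
... | false = count-remove (p ∘ suc) t pt
... | true = cong suc (trans (count-remove (p ∘ suc) t pt) (cong suc (sum-cong-≗ pointwise)))
  where
  pointwise : ∀ i → boolToℕ (p (suc i) ∧ not (does (i ≟ t))) ≡ boolToℕ (p (suc i) ∧ not (does (suc i ≟ suc t)))
  pointwise i with i ≟ t
  ... | yes _ = refl
  ... | no _ = refl

count-injection : ∀ {m k} (p : Fin m → Bool) (q : Fin k → Bool) (f : ∀ i → p i ≡ true → Fin k) →
                  (∀ i pi → q (f i pi) ≡ true) →
                  (∀ i j pi pj → f i pi ≡ f j pj → i ≡ j) →
                  count p ≤ count q
count-injection {zero} p q f f∈q f-inj = z≤n
count-injection {suc m} p q f f∈q f-inj with p zero in p0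
... | false = count-injection (p ∘ suc) q (f ∘ suc) (f∈q ∘ suc)
               (λ i j pi pj e → suc-injective (f-inj (suc i) (suc j) pi pj e))
... | true = ≤-trans (s≤s rest) (≤-reflexive (sym (count-remove q (f zero p0) (f∈q zero p0))))
  where
  q′ : Fin _ → Bool
  q′ j = q j ∧ not (does (j ≟ f zero p0))
  f∈q′ : ∀ i pi → q′ (f (suc i) pi) ≡ true
  f∈q′ i pi with f (suc i) pi ≟ f zero p0
  ... | yes e with f-inj (suc i) zero pi p0 e
  ... | ()
  f∈q′ i pi | no _ rewrite f∈q (suc i) pi = refl
  rest = count-injection (p ∘ suc) q′ (f ∘ suc) f∈q′
           (λ i j pi pj e → suc-injective (f-inj (suc i) (suc j) pi pj e))

count-atMostOne : ∀ {m} (p : Fin m → Bool) → (∀ i j → p i ≡ true → p j ≡ true → i ≡ j) → count p ≤ 1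
count-atMostOne p unique =
  count-injection {k = 1} p (λ _ → true) (λ _ _ → zero) (λ _ _ → refl) (λ i j pi pj _ → unique i j pi pj)

count-singleton : ∀ {n} (w : Fin n) → count (λ u → does (w ≟ u)) ≡ 1
count-singleton w = trans (count-remove _ w (dec-true (w ≟ w) refl)) (cong suc (count-none only-w))
  where
  only-w : ∀ u → does (w ≟ u) ∧ not (does (u ≟ w)) ≢ true
  only-w u with w ≟ u | u ≟ w
  ... | yes w≡u | no u≢w = λ _ → u≢w (sym w≡u)
  ... | yes _ | yes _ = λ ()
  ... | no _ | _ = λ ()

length-filter : ∀ {A : Set} (p : A → Bool) (xs : List A) → length (filterᵇ p xs) ≡ count (λ i → p (lookup xs i))
length-filter p [] = refl
length-filter p (x ∷ xs) with p x
... | true = cong suc (length-filter p xs)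
... | false = length-filter p xs

count-∧-≟ : ∀ {n} b (w : Fin n) → count (λ u → b ∧ does (w ≟ u)) ≡ boolToℕ b
count-∧-≟ true w = count-singleton w
count-∧-≟ {n} false w = count-false n

map-suc≢zero : ∀ {n} {i : Maybe (Fin n)} → M.map F.suc i ≢ just F.zero
map-suc≢zero {i = just _} ()
map-suc≢zero {i = nothing} ()

module _ {A : Set} (q : A → Bool) where

  filter-index : (xs : List A) → Fin (length xs) → Maybe (Fin (length (filterᵇ q xs)))
  filter-index (x ∷ xs) i with q x
  filter-index (x ∷ xs) zero | true = just zero
  filter-index (x ∷ xs) (suc i) | true = M.map suc (filter-index xs i)
  filter-index (x ∷ xs) zero | false = nothing
  filter-index (x ∷ xs) (suc i) | false = filter-index xs i

  filter-index-nothing : ∀ xs i → filter-index xs i ≡ nothing → q (lookup xs i) ≡ false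
  filter-index-nothing (x ∷ xs) i none with q x in qx
  filter-index-nothing (x ∷ xs) zero () | true
  filter-index-nothing (x ∷ xs) (suc i) none | true with filter-index xs i in fi
  filter-index-nothing (x ∷ xs) (suc i) none | true | nothing = filter-index-nothing xs i fi
  filter-index-nothing (x ∷ xs) zero none | false = qx
  filter-index-nothing (x ∷ xs) (suc i) none | false = filter-index-nothing xs i none

  filter-index-lookup : ∀ xs i {j} → filter-index xs i ≡ just j → lookup (filterᵇ q xs) j ≡ lookup xs i
  filter-index-lookup (x ∷ xs) i fi with q x
  filter-index-lookup (x ∷ xs) zero refl | true = refl
  filter-index-lookup (x ∷ xs) (suc i) fi | true with filter-index xs i in fi′
  filter-index-lookup (x ∷ xs) (suc i) refl | true | just j = filter-index-lookup xs i fi′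
  filter-index-lookup (x ∷ xs) (suc i) fi | false = filter-index-lookup xs i fi

  filter-index-injective : ∀ xs i i′ {j} → filter-index xs i ≡ just j → filter-index xs i′ ≡ just j → i ≡ i′
  filter-index-injective (x ∷ xs) i i′ fi fi′ with q x
  filter-index-injective (x ∷ xs) zero zero _ _ | true = refl
  filter-index-injective (x ∷ xs) zero (suc i′) refl fi′ | true = ⊥-elim (map-suc≢zero {i = filter-index xs i′} fi′)
  filter-index-injective (x ∷ xs) (suc i) zero fi refl | true = ⊥-elim (map-suc≢zero {i = filter-index xs i} fi)
  filter-index-injective (x ∷ xs) (suc i) (suc i′) fi fi′ | true with filter-index xs i in e | filter-index xs i′ in e′
  filter-index-injective (x ∷ xs) (suc i) (suc i′) refl refl | true | just _ | just _ =
    cong suc (filter-index-injective xs i i′ e e′)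
  filter-index-injective (x ∷ xs) zero i′ () fi′ | false
  filter-index-injective (x ∷ xs) (suc i) zero fi () | false
  filter-index-injective (x ∷ xs) (suc i) (suc i′) fi fi′ | false = cong suc (filter-index-injective xs i i′ fi fi′)

module _ {A B : Set} where

  keep-labelled : (xs : List A) → (Fin (length xs) → Maybe B) → List A
  keep-labelled [] f = []
  keep-labelled (x ∷ xs) f with f zero
  ... | just _ = x ∷ keep-labelled xs (f ∘ suc)
  ... | nothing = keep-labelled xs (f ∘ suc)

  keep-labelled-⊆ : ∀ xs f → keep-labelled xs f ⊆ xs
  keep-labelled-⊆ [] f = []
  keep-labelled-⊆ (x ∷ xs) f with f zero
  ... | just _ = refl ∷ keep-labelled-⊆ xs (f ∘ suc)
  ... | nothing = x ∷ʳ keep-labelled-⊆ xs (f ∘ suc)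

  keep-labelled-length : ∀ xs f → length (keep-labelled xs f) + count (is-nothing ∘ f) ≡ length xs
  keep-labelled-length [] f = refl
  keep-labelled-length (x ∷ xs) f with f zero
  ... | just _ = cong suc (keep-labelled-length xs (f ∘ suc))
  ... | nothing = trans (+-suc (length (keep-labelled xs (f ∘ suc))) _) (cong suc (keep-labelled-length xs (f ∘ suc)))

  kept-index : ∀ xs f → Fin (length (keep-labelled xs f)) → Fin (length xs)
  kept-index (x ∷ xs) f j with f zero
  kept-index (x ∷ xs) f zero | just _ = zero
  kept-index (x ∷ xs) f (suc j) | just _ = suc (kept-index xs (f ∘ suc) j)
  kept-index (x ∷ xs) f j | nothing = suc (kept-index xs (f ∘ suc) j)

  kept-label : ∀ xs f → Fin (length (keep-labelled xs f)) → B
  kept-label (x ∷ xs) f j with f zero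
  kept-label (x ∷ xs) f zero | just b = b
  kept-label (x ∷ xs) f (suc j) | just _ = kept-label xs (f ∘ suc) j
  kept-label (x ∷ xs) f j | nothing = kept-label xs (f ∘ suc) j

  kept-index-label : ∀ xs f j → f (kept-index xs f j) ≡ just (kept-label xs f j)
  kept-index-label (x ∷ xs) f j with f zero in f0
  kept-index-label (x ∷ xs) f zero | just _ = f0
  kept-index-label (x ∷ xs) f (suc j) | just _ = kept-index-label xs (f ∘ suc) j
  kept-index-label (x ∷ xs) f j | nothing = kept-index-label xs (f ∘ suc) j

  kept-lookup : ∀ xs f j → lookup (keep-labelled xs f) j ≡ lookup xs (kept-index xs f j)
  kept-lookup (x ∷ xs) f j with f zero
  kept-lookup (x ∷ xs) f zero | just _ = refl
  kept-lookup (x ∷ xs) f (suc j) | just _ = kept-lookup xs (f ∘ suc) j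
  kept-lookup (x ∷ xs) f j | nothing = kept-lookup xs (f ∘ suc) j

  kept-index-injective : ∀ xs f j j′ → kept-index xs f j ≡ kept-index xs f j′ → j ≡ j′
  kept-index-injective (x ∷ xs) f j j′ same with f zero
  kept-index-injective (x ∷ xs) f zero zero same | just _ = refl
  kept-index-injective (x ∷ xs) f (suc j) (suc j′) same | just _ =
    cong suc (kept-index-injective xs (f ∘ suc) j j′ (suc-injective same))
  kept-index-injective (x ∷ xs) f j j′ same | nothing = kept-index-injective xs (f ∘ suc) j j′ (suc-injective same)

max-≥ : ∀ {A : Set} (f : A → ℕ) {xs : List A} {x} → x ∈ xs → f x ≤ foldr _⊔_ 0 (map f xs)
max-≥ f (here refl) = m≤m⊔n _ _
max-≥ f {y ∷ xs} (there x∈xs) = ≤-trans (max-≥ f x∈xs) (m≤n⊔m (f y) _)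

max-≤ : ∀ {A : Set} (f : A → ℕ) (xs : List A) {B} → (∀ x → f x ≤ B) → foldr _⊔_ 0 (map f xs) ≤ B
max-≤ f [] f≤B = z≤n
max-≤ f (x ∷ xs) f≤B = ⊔-lub (f≤B x) (max-≤ f xs f≤B)

deg≤maxDeg : ∀ {n} (es : List (Edge n)) x → deg es x ≤ maxDeg n es
deg≤maxDeg {n} es x = max-≥ (deg es) (∈-allFin x)

length-filter-filter : ∀ {A : Set} (p q : A → Bool) (xs : List A) → length (filterᵇ p (filterᵇ q xs)) ≤ length (filterᵇ p xs)
length-filter-filter p q [] = z≤n
length-filter-filter p q (x ∷ xs) with q x
... | true with p x
...   | true = s≤s (length-filter-filter p q xs)
...   | false = length-filter-filter p q xs
length-filter-filter p q (x ∷ xs) | false with p x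
...   | true = m≤n⇒m≤1+n (length-filter-filter p q xs)
...   | false = length-filter-filter p q xs

maxDeg-filter : ∀ n (es : List (Edge n)) q → maxDeg n (filterᵇ q es) ≤ maxDeg n es
maxDeg-filter n es q = max-≤ _ (allFin n) (λ x → ≤-trans (length-filter-filter (incident x) q es) (deg≤maxDeg es x))

colorable-weaken : ∀ {n k k′} (es : List (Edge n)) → k ≤ k′ → Colorable k es → Colorable k′ es
colorable-weaken es k≤k′ (κ , κ-proper) =
  (λ i → inject≤ (κ i) k≤k′) , λ i j i≢j share eq → κ-proper i j i≢j share (inject≤-injective k≤k′ k≤k′ _ _ eq)

∣∣≡count : ∀ {n} (S : Subset n) → ∣ S ∣ ≡ count (Vec.lookup S)
∣∣≡count [] = refl
∣∣≡count (true ∷ S) = cong suc (∣∣≡count S)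
∣∣≡count (false ∷ S) = ∣∣≡count S

≤⌊/2⌋ : ∀ a d → a + a ≤ d → a ≤ ⌊ d /2⌋
≤⌊/2⌋ a d a+a≤d = ≤-trans (≤-reflexive (n≡⌊n+n/2⌋ a)) (⌊n/2⌋-mono a+a≤d)

-- Alternating paths in two matchings

record IsMatching {n : ℕ} (μ : Fin n → Maybe (Fin n)) : Set where
  field
    symmetric   : ∀ {x y} → μ x ≡ just y → μ y ≡ just x
    irreflexive : ∀ {x} → μ x ≢ just x

  partner-unique : ∀ {x y z} → μ y ≡ just x → μ z ≡ just x → y ≡ z
  partner-unique μy μz = just-injective (trans (sym (symmetric μy)) (symmetric μz))

last-defined : ∀ {A : Set} (f : ℕ → Maybe A) N → (∃ λ a → f 0 ≡ just a) → f N ≡ nothing →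
               ∃ λ m → m < N × (∃ λ a → f m ≡ just a) × f (suc m) ≡ nothing
last-defined f zero (a , f0) fN with trans (sym f0) fN
... | ()
last-defined f (suc N) f0 fN+1 with f N in fN
... | nothing = let (m , m<N , fm , fm+1) = last-defined f N f0 fN in m , m≤n⇒m≤1+n m<N , fm , fm+1
... | just a = N , n<1+n N , (a , fN) , fN+1

-- μ true and μ false play the roles of the α-edges and the β-edges of a proper edge colouring.
module AlternatingPaths {n : ℕ} (μ : Bool → Fin n → Maybe (Fin n))
                        (matching : ∀ b → IsMatching (μ b)) where

  open module Matching b = IsMatching (matching b)

  Closed : (Fin n → Bool) → Set
  Closed K = ∀ b {x y} → K x ≡ true → μ b x ≡ just y → K y ≡ true

  -- The maximal alternating walk from u, leaving u along μ true; a state (x , b) means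
  -- the walk is at x and continues along μ b.
  module WalkFrom (u : Fin n) (u-free : μ false u ≡ nothing) where

    State : Set
    State = Fin n × Bool

    advance : Maybe State → Maybe State
    advance nothing = nothing
    advance (just (x , b)) = M.map (λ y → y , not b) (μ b x)

    walk : ℕ → Maybe State
    walk zero = just (u , true)
    walk (suc i) = advance (walk i)

    advance-prev : ∀ s {y b} → advance s ≡ just (y , b) → ∃ λ x → s ≡ just (x , not b) × μ (not b) x ≡ just y
    advance-prev (just (x , b)) e with μ b x in μx
    advance-prev (just (x , b)) refl | just y =
      x , cong (λ c → just (x , c)) (sym (not-involutive b)) ,
      subst (λ c → μ c x ≡ just y) (sym (not-involutive b)) μx

    walk-prev : ∀ i {y b} → walk (suc i) ≡ just (y , b) → ∃ λ x → walk i ≡ just (x , not b) × μ (not b) x ≡ just y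
    walk-prev i = advance-prev (walk i)

    walk-next : ∀ i {x b y} → walk i ≡ just (x , b) → μ b x ≡ just y → walk (suc i) ≡ just (y , not b)
    walk-next i walk-i μx rewrite walk-i | μx = refl

    walk-defined-below : ∀ {i j} → i ≤ j → ∀ {s} → walk j ≡ just s → ∃ λ s′ → walk i ≡ just s′
    walk-defined-below {i} {j} i≤j {s} walk-j with m≤n⇒m<n∨m≡n i≤j
    ... | inj₂ refl = s , walk-j
    walk-defined-below {j = suc j} i≤j {s} walk-j | inj₁ i<j+1 =
      let (x , walk-j′ , _) = walk-prev j {proj₁ s} {proj₂ s} walk-j
      in walk-defined-below (≤-pred i<j+1) walk-j′

    Distinct : ℕ → Set
    Distinct j = ∀ i {x b x′ b′} → i < j → walk i ≡ just (x , b) → walk j ≡ just (x′ , b′) → x ≢ x′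

    returns-to-start : ∀ j → Distinct j → ∀ b {y} → μ (not b) u ≡ just y → walk j ≡ just (y , not b) → ⊥
    returns-to-start j D true μu walk-j with trans (sym u-free) μu
    ... | ()
    returns-to-start zero D false μu walk-j =
      irreflexive true (subst (λ z → μ true u ≡ just z) (sym (,-injectiveˡ (just-injective walk-j))) μu)
    returns-to-start (suc zero) D false μu walk-j with trans (sym walk-j) (walk-next 0 refl μu)
    ... | ()
    returns-to-start (suc (suc j)) D false μu walk-j = D 1 (s≤s (s≤s z≤n)) (walk-next 0 refl μu) walk-j refl

    -- A first repetition would give a vertex two partners in one matching, or u a partner in μ false.
    distinct-suc : ∀ j → Distinct j → Distinct (suc j)
    distinct-suc j D i {x} {b} {_} {b′} i<j+1 walk-i walk-j+1 refl with walk-prev j walk-j+1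
    ... | y , walk-j , μy = revisit i i<j+1 walk-i
      where
      μx : μ (not b′) x ≡ just y
      μx = symmetric (not b′) μy
      revisit : ∀ i → i < suc j → walk i ≡ just (x , b) → ⊥
      revisit zero _ refl = returns-to-start j D b′ μx walk-j
      revisit (suc i₀) i<j+1 walk-i with walk-prev i₀ walk-i | b′ B.≟ b
      ... | z , walk-i₀ , μz | yes refl = D i₀ (≤-pred i<j+1) walk-i₀ walk-j (partner-unique (not b) μz μy)
      ... | z , walk-i₀ , μz | no b′≢b = continues (m≤n⇒m<n∨m≡n (≤-pred i<j+1))
        where
        μbx : μ b x ≡ just y
        μbx = subst (λ c → μ c x ≡ just y) (trans (cong not (¬-not b′≢b)) (not-involutive b)) μx
        walk-i+1 : walk (suc (suc i₀)) ≡ just (y , not b)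
        walk-i+1 = walk-next (suc i₀) walk-i μbx
        continues : suc i₀ < j ⊎ suc i₀ ≡ j → ⊥
        continues (inj₂ i+1≡j) = irreflexive b (subst (λ c → μ b x ≡ just c) y≡x μbx)
          where
          y≡x : y ≡ x
          y≡x = ,-injectiveˡ (just-injective (trans (sym walk-j) (subst (λ k → walk k ≡ just (x , b)) i+1≡j walk-i)))
        continues (inj₁ i+1<j) with m≤n⇒m<n∨m≡n i+1<j
        ... | inj₁ i+2<j = D (suc (suc i₀)) i+2<j walk-i+1 walk-j refl
        ... | inj₂ i+2≡j = b′≢b (not-injective (,-injectiveʳ (just-injective
                             (trans (sym walk-j) (subst (λ k → walk k ≡ just (y , not b)) i+2≡j walk-i+1)))))

    distinct : ∀ j → Distinct j
    distinct zero i ()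
    distinct (suc j) = distinct-suc j (distinct j)

    walk-stops : walk n ≡ nothing
    walk-stops with walk n in walk-n
    ... | nothing = refl
    ... | just _ = ⊥-elim (no-repeat (pigeonhole (n<1+n n) vertex))
      where
      defined : (k : Fin (suc n)) → ∃ λ s → walk (toℕ k) ≡ just s
      defined k = walk-defined-below (≤-pred (toℕ<n k)) walk-n
      vertex : Fin (suc n) → Fin n
      vertex k = proj₁ (proj₁ (defined k))
      no-repeat : (∃ λ i → ∃ λ j → i F.< j × vertex i ≡ vertex j) → ⊥
      no-repeat (i , j , i<j , same) = distinct (toℕ j) (toℕ i) i<j (proj₂ (defined i)) (proj₂ (defined j)) same

    last : ∃ λ m → m < n × (∃ λ s → walk m ≡ just s) × walk (suc m) ≡ nothing
    last = last-defined walk n ((u , true) , refl) walk-stops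

    m : ℕ
    m = proj₁ last

    walk-m : ∃ λ s → walk m ≡ just s
    walk-m = proj₁ (proj₂ (proj₂ last))

    walk-m+1 : walk (suc m) ≡ nothing
    walk-m+1 = proj₂ (proj₂ (proj₂ last))

    end : Fin n
    end = proj₁ (proj₁ walk-m)

    visited? : (x : Fin n) → Dec (∃ λ (k : Fin (suc m)) → M.map proj₁ (walk (toℕ k)) ≡ just x)
    visited? x = any? (λ k → MP.≡-dec _≟_ (M.map proj₁ (walk (toℕ k))) (just x))

    K : Fin n → Bool
    K x = does (visited? x)

    K-intro : ∀ i {x b} → i ≤ m → walk i ≡ just (x , b) → K x ≡ true
    K-intro i {x} i≤m walk-i = dec-true (visited? x)
      (fromℕ< (s≤s i≤m) ,
       subst (λ k → M.map proj₁ (walk k) ≡ just x) (sym (toℕ-fromℕ< (s≤s i≤m))) (cong (M.map proj₁) walk-i))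

    K-elim : ∀ {x} → K x ≡ true → ∃ λ i → i ≤ m × ∃ λ b → walk i ≡ just (x , b)
    K-elim {x} Kx with from-does (visited? x) Kx
    ... | k , walk-k = toℕ k , ≤-pred (toℕ<n k) , state (walk (toℕ k)) walk-k
      where
      state : ∀ s → M.map proj₁ s ≡ just x → ∃ λ b → s ≡ just (x , b)
      state (just (x , b)) refl = b , refl

    K-start : K u ≡ true
    K-start = K-intro 0 z≤n refl

    K-closed : Closed K
    K-closed b {x} {y} Kx μx with K-elim Kx
    ... | i , i≤m , b′ , walk-i with b B.≟ b′
    ... | yes refl with m≤n⇒m<n∨m≡n i≤m
    ...   | inj₁ i<m = K-intro (suc i) i<m (walk-next i walk-i μx)
    ...   | inj₂ refl with trans (sym (walk-next i walk-i μx)) walk-m+1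
    ...     | ()
    K-closed b {x} {y} Kx μx | zero , _ , b′ , refl | no b≢b′
      with trans (sym u-free) (subst (λ c → μ c u ≡ just y) (¬-not b≢b′) μx)
    ... | ()
    K-closed b {x} {y} Kx μx | suc i₀ , i≤m , b′ , walk-i | no b≢b′ with walk-prev i₀ walk-i
    ... | z , walk-i₀ , μz =
      K-intro i₀ (≤-trans (n≤1+n i₀) i≤m) (subst (λ c → walk i₀ ≡ just (c , not b′)) z≡y walk-i₀)
      where
      z≡y : z ≡ y
      z≡y = partner-unique (not b′) μz (subst (λ c → μ c y ≡ just x) (¬-not b≢b′) (symmetric b μx))

    interior-matched : ∀ {x} → K x ≡ true → x ≢ u → x ≢ end → ∀ b → μ b x ≢ nothing
    interior-matched {x} Kx x≢u x≢end b μx with K-elim Kx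
    ... | zero , _ , b′ , walk-0 = x≢u (sym (,-injectiveˡ (just-injective walk-0)))
    ... | suc i₀ , i≤m , b′ , walk-i with m≤n⇒m<n∨m≡n i≤m
    ...   | inj₂ i≡m =
      x≢end (,-injectiveˡ (just-injective (trans (sym (subst (λ k → walk k ≡ just (x , b′)) i≡m walk-i)) (proj₂ walk-m))))
    ...   | inj₁ i<m with walk-prev i₀ walk-i | b B.≟ b′
    ...     | z , walk-i₀ , μz | no b≢b′
      with trans (sym μx) (subst (λ c → μ c x ≡ just z) (sym (¬-not b≢b′)) (symmetric (not b′) μz))
    ...       | ()
    interior-matched {x} Kx x≢u x≢end b μx | suc i₀ , i≤m , b′ , walk-i | inj₁ i<m | _ | yes refl
      with walk-defined-below i<m (proj₂ walk-m)
    ...   | s , walk-i+1 with trans (sym walk-i+1) stuck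
      where
      stuck : walk (suc (suc i₀)) ≡ nothing
      stuck rewrite walk-i | μx = refl
    ...     | ()

  Closed-complement : ∀ {K} → Closed K → Closed (λ x → not (K x))
  Closed-complement {K} K-closed b {x} {y} ¬Kx μx with K y in Ky | K x in Kx
  ... | false | _ = refl
  ... | true | false with trans (sym Kx) (K-closed b Ky (symmetric b μx))
  ...   | ()
  Closed-complement {K} K-closed b {x} {y} () μx | true | true

  -- The component of u₁ in the union of the two matchings is a path ending at u₁; u₂ and v have
  -- degree at most one there, so they cannot both lie on it unless both are its other end.
  kempe-separation : ∀ {u₁ u₂ v} → u₁ ≢ u₂ → u₁ ≢ v → u₂ ≢ v →
                     μ false u₁ ≡ nothing → μ false u₂ ≡ nothing → μ true v ≡ nothing →
                     ∃ λ K → Closed K × K v ≡ false × (K u₁ ≡ true ⊎ K u₂ ≡ true)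
  kempe-separation {u₁} {u₂} {v} u₁≢u₂ u₁≢v u₂≢v u₁-free u₂-free v-free with WalkFrom.K u₁ u₁-free v in Kv
  ... | false = W.K , W.K-closed , Kv , inj₁ W.K-start
    where module W = WalkFrom u₁ u₁-free
  ... | true = (λ x → not (W.K x)) , Closed-complement W.K-closed , cong not Kv , inj₂ u₂-outside
    where
    module W = WalkFrom u₁ u₁-free
    v≡end : v ≡ W.end
    v≡end with v ≟ W.end
    ... | yes v≡end = v≡end
    ... | no v≢end = ⊥-elim (W.interior-matched Kv (u₁≢v ∘ sym) v≢end true v-free)
    u₂-outside : not (W.K u₂) ≡ true
    u₂-outside with W.K u₂ in Ku₂
    ... | false = refl
    ... | true = ⊥-elim (W.interior-matched Ku₂ (u₁≢u₂ ∘ sym) (λ u₂≡end → u₂≢v (trans u₂≡end (sym v≡end)))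
                                            false u₂-free)

module _ {n : ℕ} where

  other-end : Fin n → Edge n → Fin n
  other-end x (a , b) = if does (a ≟ x) then b else a

  incident-fst : (e : Edge n) → incident (proj₁ e) e ≡ true
  incident-fst (a , b) rewrite dec-true (a ≟ a) refl = refl

  incident-snd : (e : Edge n) → incident (proj₂ e) e ≡ true
  incident-snd (a , b) rewrite dec-true (b ≟ b) refl = ∨-zeroʳ _

  incident-cases : ∀ x e → incident x e ≡ true →
                   (proj₁ e ≡ x × other-end x e ≡ proj₂ e) ⊎ (proj₂ e ≡ x × other-end x e ≡ proj₁ e)
  incident-cases x (a , b) x∈e with a ≟ x | b ≟ x
  ... | yes a≡x | _ = inj₁ (a≡x , refl)
  ... | no _ | yes b≡x = inj₂ (b≡x , refl)
  incident-cases x (a , b) () | no _ | no _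

  incident-other-end : ∀ x e → incident x e ≡ true → incident (other-end x e) e ≡ true
  incident-other-end x e x∈e with incident-cases x e x∈e
  ... | inj₁ (_ , o) rewrite o = incident-snd e
  ... | inj₂ (_ , o) rewrite o = incident-fst e

  incident-ends : ∀ x y e → incident x e ≡ true → incident y e ≡ true → y ≡ x ⊎ y ≡ other-end x e
  incident-ends x y e x∈e y∈e with incident-cases x e x∈e | incident-cases y e y∈e
  ... | inj₁ (a≡x , _) | inj₁ (a≡y , _) = inj₁ (trans (sym a≡y) a≡x)
  ... | inj₁ (_ , o) | inj₂ (b≡y , _) = inj₂ (trans (sym b≡y) (sym o))
  ... | inj₂ (_ , o) | inj₁ (a≡y , _) = inj₂ (trans (sym a≡y) (sym o))
  ... | inj₂ (b≡x , _) | inj₂ (b≡y , _) = inj₁ (trans (sym b≡y) b≡x)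

  other-end-≢ : ∀ x e → proj₁ e ≢ proj₂ e → incident x e ≡ true → other-end x e ≢ x
  other-end-≢ x e a≢b x∈e with incident-cases x e x∈e
  ... | inj₁ (a≡x , o) = λ o≡x → a≢b (trans a≡x (trans (sym o≡x) o))
  ... | inj₂ (b≡x , o) = λ o≡x → a≢b (trans (sym o) (trans o≡x (sym b≡x)))

  other-end-involutive : ∀ x e → proj₁ e ≢ proj₂ e → incident x e ≡ true → other-end (other-end x e) e ≡ x
  other-end-involutive x e a≢b x∈e with incident-ends x (other-end x e) e x∈e (incident-other-end x e x∈e)
  ... | inj₁ o≡x = ⊥-elim (other-end-≢ x e a≢b x∈e o≡x)
  ... | inj₂ _ with incident-ends (other-end x e) x e (incident-other-end x e x∈e) x∈e
  ...   | inj₁ x≡o = ⊥-elim (other-end-≢ x e a≢b x∈e (sym x≡o))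
  ...   | inj₂ x≡oo = sym x≡oo

  share-of-incident : ∀ x (e f : Edge n) → incident x e ≡ true → incident x f ≡ true → ShareEnd e f
  share-of-incident x e f x∈e x∈f with incident-cases x e x∈e | incident-cases x f x∈f
  ... | inj₁ (a≡x , _) | inj₁ (c≡x , _) = inj₁ (trans a≡x (sym c≡x))
  ... | inj₁ (a≡x , _) | inj₂ (d≡x , _) = inj₂ (inj₁ (trans a≡x (sym d≡x)))
  ... | inj₂ (b≡x , _) | inj₁ (c≡x , _) = inj₂ (inj₂ (inj₁ (trans b≡x (sym c≡x))))
  ... | inj₂ (b≡x , _) | inj₂ (d≡x , _) = inj₂ (inj₂ (inj₂ (trans b≡x (sym d≡x))))

  incident-of-share : ∀ (e f : Edge n) → ShareEnd e f → ∃ λ x → incident x e ≡ true × incident x f ≡ true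
  incident-of-share (a , b) (c , d) (inj₁ refl) = a , incident-fst (a , b) , incident-fst (a , d)
  incident-of-share (a , b) (c , d) (inj₂ (inj₁ refl)) = a , incident-fst (a , b) , incident-snd (c , a)
  incident-of-share (a , b) (c , d) (inj₂ (inj₂ (inj₁ refl))) = b , incident-snd (a , b) , incident-fst (b , d)
  incident-of-share (a , b) (c , d) (inj₂ (inj₂ (inj₂ refl))) = b , incident-snd (a , b) , incident-snd (c , b)

-- Partial edge colourings

module PartialColoring {n : ℕ} (E : List (Edge n)) (loopless : All (λ e → proj₁ e ≢ proj₂ e) E) (D : ℕ) where

  inc : Fin n → Fin (length E) → Bool
  inc x i = incident x (lookup E i)

  other : Fin n → Fin (length E) → Fin n
  other x i = other-end x (lookup E i)

  non-loop : ∀ i → proj₁ (lookup E i) ≢ proj₂ (lookup E i)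
  non-loop i = All.lookup loopless (∈-lookup i)

  Coloring : Set
  Coloring = Fin (length E) → Maybe (Fin D)

  Proper : Coloring → Set
  Proper c = ∀ x i j γ → i ≢ j → inc x i ≡ true → inc x j ≡ true → c i ≡ just γ → c j ≡ just γ → ⊥

  #uncolored : Coloring → ℕ
  #uncolored c = count (λ i → is-nothing (c i))

  colored-deg uncolored-deg : Coloring → Fin n → ℕ
  colored-deg c x = count (λ i → inc x i ∧ is-just (c i))
  uncolored-deg c x = count (λ i → inc x i ∧ is-nothing (c i))

  deg-split : ∀ c x → colored-deg c x + uncolored-deg c x ≡ count (inc x)
  deg-split c x = count-split (inc x) (λ i → is-just (c i))

  EdgeColored : Coloring → Fin D → Fin n → Set
  EdgeColored c γ x = ∃ λ i → c i ≡ just γ × inc x i ≡ true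

  edge-colored? : ∀ c γ x → Dec (EdgeColored c γ x)
  edge-colored? c γ x = any? (λ i → MP.≡-dec _≟_ (c i) (just γ) ×-dec (inc x i B.≟ true))

  partner-via : ∀ {c γ x} → Dec (EdgeColored c γ x) → Maybe (Fin n)
  partner-via {x = x} (yes (i , _)) = just (other x i)
  partner-via (no _) = nothing

  partner : Coloring → Fin D → Fin n → Maybe (Fin n)
  partner c γ x = partner-via (edge-colored? c γ x)

  used missing : Coloring → Fin D → Fin n → Bool
  used c γ x = is-just (partner c γ x)
  missing c γ x = not (used c γ x)

  partner-just : ∀ {c γ x y} → partner c γ x ≡ just y → ∃ λ i → c i ≡ just γ × inc x i ≡ true × other x i ≡ y
  partner-just {c} {γ} {x} = via (edge-colored? c γ x)
    where
    via : ∀ {y} (d : Dec (EdgeColored c γ x)) → partner-via d ≡ just y →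
          ∃ λ i → c i ≡ just γ × inc x i ≡ true × other x i ≡ y
    via (yes (i , ci , x∈i)) refl = i , ci , x∈i , refl

  partner-nothing : ∀ {c γ x} → partner c γ x ≡ nothing → ∀ i → inc x i ≡ true → c i ≢ just γ
  partner-nothing {c} {γ} {x} = via (edge-colored? c γ x)
    where
    via : (d : Dec (EdgeColored c γ x)) → partner-via d ≡ nothing → ∀ i → inc x i ≡ true → c i ≢ just γ
    via (no none) _ i x∈i ci = none (i , ci , x∈i)

  partner-of-edge : ∀ {c γ x} → Proper c → ∀ i → c i ≡ just γ → inc x i ≡ true → partner c γ x ≡ just (other x i)
  partner-of-edge {c} {γ} {x} proper i ci x∈i = via (edge-colored? c γ x)
    where
    via : (d : Dec (EdgeColored c γ x)) → partner-via d ≡ just (other x i)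
    via (no none) = ⊥-elim (none (i , ci , x∈i))
    via (yes (j , cj , x∈j)) with i ≟ j
    ... | yes refl = refl
    ... | no i≢j = ⊥-elim (proper x i j γ i≢j x∈i x∈j ci cj)

  missing-partner : ∀ {c γ x} → missing c γ x ≡ true → partner c γ x ≡ nothing
  missing-partner {c} {γ} {x} _ with partner c γ x
  missing-partner () | just _
  ... | nothing = refl

  partner-matching : ∀ {c} → Proper c → ∀ γ → IsMatching (partner c γ)
  partner-matching {c} proper γ = record
    { symmetric = symmetric
    ; irreflexive = λ p≡x → let (i , _ , x∈i , o≡x) = partner-just p≡x in other-end-≢ _ _ (non-loop i) x∈i o≡x
    }
    where
    symmetric : ∀ {x y} → partner c γ x ≡ just y → partner c γ y ≡ just x
    symmetric {x} p≡y with partner-just p≡y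
    ... | i , ci , x∈i , refl =
      trans (partner-of-edge proper i ci (incident-other-end x (lookup E i) x∈i))
            (cong just (other-end-involutive x (lookup E i) (non-loop i) x∈i))

  #used≤colored-deg : ∀ c x → count (λ γ → used c γ x) ≤ colored-deg c x
  #used≤colored-deg c x = count-injection _ _ edge-of colored-at-x injective
    where
    edge-via : ∀ {γ} (d : Dec (EdgeColored c γ x)) → is-just (partner-via d) ≡ true → EdgeColored c γ x
    edge-via (yes e) _ = e
    edge-of : ∀ γ → used c γ x ≡ true → Fin (length E)
    edge-of γ u = proj₁ (edge-via (edge-colored? c γ x) u)
    edge-of-spec : ∀ γ u → c (edge-of γ u) ≡ just γ × inc x (edge-of γ u) ≡ true
    edge-of-spec γ u = proj₂ (edge-via (edge-colored? c γ x) u)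
    colored-at-x : ∀ γ u → (inc x (edge-of γ u) ∧ is-just (c (edge-of γ u))) ≡ true
    colored-at-x γ u with edge-of-spec γ u
    ... | ci , x∈i rewrite ci | x∈i = refl
    injective : ∀ γ γ′ u u′ → edge-of γ u ≡ edge-of γ′ u′ → γ ≡ γ′
    injective γ γ′ u u′ same = just-injective (trans (sym (proj₁ (edge-of-spec γ u)))
                                 (trans (cong c same) (proj₁ (edge-of-spec γ′ u′))))

  #missing+#used : ∀ c x → count (λ γ → missing c γ x) + count (λ γ → used c γ x) ≡ D
  #missing+#used c x = trans (+-comm (count (λ γ → missing c γ x)) _)
                             (trans (count-split (λ _ → true) (λ γ → used c γ x)) (count-true D))

  -- Applies the transposition (α β) to the edges whose first end lies in K; as K is closed under
  -- αβ-edges, both ends of an αβ-edge lie on the same side of K.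
  module Interchange (c : Coloring) (proper : Proper c) (α β : Fin D) (K : Fin n → Bool)
    (closed : ∀ {γ} → γ ≡ α ⊎ γ ≡ β → ∀ {x y} → K x ≡ true → partner c γ x ≡ just y → K y ≡ true) where

    σ : Fin D → Fin D
    σ = transpose α β

    σ-injective : ∀ {γ δ} → σ γ ≡ σ δ → γ ≡ δ
    σ-injective {γ} {δ} σγ≡σδ =
      trans (sym (transpose-inverse β α)) (trans (cong (transpose β α) σγ≡σδ) (transpose-inverse β α))

    σ-fixes : ∀ {γ} → γ ≢ α → γ ≢ β → σ γ ≡ γ
    σ-fixes {γ} γ≢α γ≢β rewrite dec-false (γ ≟ α) γ≢α | dec-false (γ ≟ β) γ≢β = refl

    σ-to-α : ∀ {γ} → M.map σ γ ≡ just α → γ ≡ just β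
    σ-to-α {just γ} σγ≡α with γ ≟ α
    ... | yes γ≡α = cong just (trans γ≡α (sym (just-injective σγ≡α)))
    ... | no γ≢α with γ ≟ β
    ...   | yes γ≡β = cong just γ≡β
    ...   | no _ = ⊥-elim (γ≢α (just-injective σγ≡α))

    αβ? : ∀ γ → (γ ≡ α ⊎ γ ≡ β) ⊎ (γ ≢ α × γ ≢ β)
    αβ? γ with γ ≟ α | γ ≟ β
    ... | yes γ≡α | _ = inj₁ (inj₁ γ≡α)
    ... | no _ | yes γ≡β = inj₁ (inj₂ γ≡β)
    ... | no γ≢α | no γ≢β = inj₂ (γ≢α , γ≢β)

    swap-if : Bool → Maybe (Fin D) → Maybe (Fin D)
    swap-if b γ = if b then M.map σ γ else γ

    swap-if-nothing : ∀ b → swap-if b nothing ≡ nothing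
    swap-if-nothing true = refl
    swap-if-nothing false = refl

    swap-if-just : ∀ b {γ δ} → swap-if b γ ≡ just δ → ∃ λ δ′ → γ ≡ just δ′
    swap-if-just true {just γ} _ = γ , refl
    swap-if-just false {just γ} _ = γ , refl

    swap-if-injective : ∀ b {γ δ} → swap-if b γ ≡ swap-if b δ → γ ≡ δ
    swap-if-injective true = map-injective σ-injective
    swap-if-injective false = λ γ≡δ → γ≡δ

    c′ : Coloring
    c′ i = swap-if (K (proj₁ (lookup E i))) (c i)

    K-along-edge : ∀ x i {γ} → inc x i ≡ true → c i ≡ just γ → γ ≡ α ⊎ γ ≡ β → K (proj₁ (lookup E i)) ≡ K x
    K-along-edge x i x∈i ci αβ with incident-cases x (lookup E i) x∈i
    ... | inj₁ (fst≡x , _) = cong K fst≡x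
    ... | inj₂ (_ , o≡fst) = subst (λ z → K z ≡ K x) o≡fst (same-side (partner-of-edge proper i ci x∈i))
      where
      same-side : ∀ {y} → partner c _ x ≡ just y → K y ≡ K x
      same-side {y} x→y with K x in Kx | K y in Ky
      ... | true | true = refl
      ... | false | false = refl
      ... | true | false = trans (sym Ky) (closed αβ Kx x→y)
      ... | false | true = trans (sym (closed αβ Ky (IsMatching.symmetric (partner-matching proper _) x→y))) Kx

    recolor-at : ∀ x i → inc x i ≡ true → c′ i ≡ swap-if (K x) (c i)
    recolor-at x i x∈i with c i in ci
    ... | nothing = trans (swap-if-nothing (K (proj₁ (lookup E i)))) (sym (swap-if-nothing (K x)))
    ... | just γ with αβ? γ
    ...   | inj₁ αβ rewrite K-along-edge x i x∈i ci αβ = refl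
    ...   | inj₂ (γ≢α , γ≢β) = trans (fixed (K (proj₁ (lookup E i)))) (sym (fixed (K x)))
      where fixed : ∀ b → swap-if b (just γ) ≡ just γ
            fixed true = cong just (σ-fixes γ≢α γ≢β)
            fixed false = refl

    recolor-proper : Proper c′
    recolor-proper x i j γ i≢j x∈i x∈j c′i c′j = proper x i j δ i≢j x∈i x∈j ci (trans (sym ci≡cj) ci)
      where
      ci≡cj : c i ≡ c j
      ci≡cj = swap-if-injective (K x) (trans (sym (recolor-at x i x∈i)) (trans c′i (trans (sym c′j) (recolor-at x j x∈j))))
      colored : ∃ λ δ → c i ≡ just δ
      colored = swap-if-just (K x) (trans (sym (recolor-at x i x∈i)) c′i)
      δ = proj₁ colored
      ci = proj₂ colored

    recolor-is-just : ∀ i → is-just (c′ i) ≡ is-just (c i)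
    recolor-is-just i with K (proj₁ (lookup E i)) | c i
    ... | true | just _ = refl
    ... | true | nothing = refl
    ... | false | _ = refl

    α-missing-inside : ∀ {u} → K u ≡ true → partner c β u ≡ nothing → ∀ i → inc u i ≡ true → c′ i ≢ just α
    α-missing-inside {u} Ku no-β i u∈i c′i =
      partner-nothing no-β i u∈i (σ-to-α (trans (cong (λ b → swap-if b (c i)) (sym Ku)) (trans (sym (recolor-at u i u∈i)) c′i)))

    unchanged-outside : ∀ {v} → K v ≡ false → ∀ i → inc v i ≡ true → c′ i ≡ c i
    unchanged-outside {v} Kv i v∈i rewrite recolor-at v i v∈i | Kv = refl

  Misses : Coloring → Fin D → Fin n → Set
  Misses c γ x = ∀ i → inc x i ≡ true → c i ≢ just γ

  Uncolored⊆ : Coloring → Coloring → Set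
  Uncolored⊆ c′ c = ∀ i → c′ i ≡ nothing → c i ≡ nothing

  Improvement : Coloring → Set
  Improvement c = Σ Coloring λ c′ → Proper c′ × Uncolored⊆ c′ c × #uncolored c′ < #uncolored c

  assign : Coloring → Fin (length E) → Fin D → Coloring
  assign c e γ i = if does (i ≟ e) then just γ else c i

  assign-improvement : ∀ {c v e γ} → Proper c → inc v e ≡ true → c e ≡ nothing →
                       Misses c γ v → Misses c γ (other v e) → Improvement c
  assign-improvement {c} {v} {e} {γ} proper v∈e ce≡nothing γ∉v γ∉w =
    assign c e γ , assign-proper , assign-uncolored , assign-decreases
    where
    γ∉ends : ∀ x i → inc x e ≡ true → inc x i ≡ true → c i ≢ just γ
    γ∉ends x i x∈e x∈i with incident-ends v x (lookup E e) v∈e x∈e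
    ... | inj₁ refl = γ∉v i x∈i
    ... | inj₂ refl = γ∉w i x∈i

    assign-proper : Proper (assign c e γ)
    assign-proper x i j δ i≢j x∈i x∈j ci cj with i ≟ e | j ≟ e
    ... | yes refl | yes refl = i≢j refl
    ... | yes refl | no _ = γ∉ends x j x∈i x∈j (trans cj (sym ci))
    ... | no _ | yes refl = γ∉ends x i x∈j x∈i (trans ci (sym cj))
    ... | no _ | no _ = proper x i j δ i≢j x∈i x∈j ci cj

    assign-uncolored : Uncolored⊆ (assign c e γ) c
    assign-uncolored i ai≡nothing with i ≟ e
    assign-uncolored i () | yes _
    ... | no _ = ai≡nothing

    assign-decreases : #uncolored (assign c e γ) < #uncolored c
    assign-decreases = ≤-trans (s≤s (count-mono still-uncolored))
                               (≤-reflexive (sym (count-remove _ e (cong is-nothing ce≡nothing))))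
      where
      still-uncolored : ∀ i → is-nothing (assign c e γ i) ≡ true → (is-nothing (c i) ∧ not (does (i ≟ e))) ≡ true
      still-uncolored i _ with i ≟ e
      still-uncolored i () | yes _
      still-uncolored i u | no _ rewrite u = refl

  improvement-transport : ∀ {c₀ c} → Uncolored⊆ c₀ c → #uncolored c₀ ≡ #uncolored c → Improvement c₀ → Improvement c
  improvement-transport ⊆c #≡ (c′ , proper′ , ⊆c₀ , c′<c₀) =
    c′ , proper′ , (λ i → ⊆c i ∘ ⊆c₀ i) , <-≤-trans c′<c₀ (≤-reflexive #≡)

  is-just-false : ∀ {A : Set} {m : Maybe A} → is-just m ≡ false → m ≡ nothing
  is-just-false {m = nothing} _ = refl

  -- Kempe's argument: interchanging α and β on an αβ-closed set containing u₁ or u₂ but not v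
  -- frees α at that neighbour while keeping it free at v.
  kempe-improvement : ∀ {c v e₁ e₂ α β} → Proper c →
                      inc v e₁ ≡ true → c e₁ ≡ nothing → inc v e₂ ≡ true → c e₂ ≡ nothing →
                      other v e₁ ≢ other v e₂ → partner c α v ≡ nothing →
                      partner c β (other v e₁) ≡ nothing → partner c β (other v e₂) ≡ nothing →
                      Improvement c
  kempe-improvement {c} {v} {e₁} {e₂} {α} {β}
                    proper v∈e₁ e₁-uncolored v∈e₂ e₂-uncolored u₁≢u₂ α∉v β∉u₁ β∉u₂ =
    improve (kempe-separation u₁≢u₂ (other-end-≢ v (lookup E e₁) (non-loop e₁) v∈e₁)
                              (other-end-≢ v (lookup E e₂) (non-loop e₂) v∈e₂) β∉u₁ β∉u₂ α∉v)
    where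
    μ : Bool → Fin n → Maybe (Fin n)
    μ true = partner c α
    μ false = partner c β
    matching : ∀ b → IsMatching (μ b)
    matching true = partner-matching proper α
    matching false = partner-matching proper β
    open AlternatingPaths μ matching using (Closed; kempe-separation)

    improve : (∃ λ K → Closed K × K v ≡ false × (K (other v e₁) ≡ true ⊎ K (other v e₂) ≡ true)) → Improvement c
    improve (K , K-closed , Kv , Ku) =
      [ after-interchange v∈e₁ e₁-uncolored β∉u₁ , after-interchange v∈e₂ e₂-uncolored β∉u₂ ]′ Ku
      where
      closed-αβ : ∀ {γ} → γ ≡ α ⊎ γ ≡ β → ∀ {x y} → K x ≡ true → partner c γ x ≡ just y → K y ≡ true
      closed-αβ (inj₁ refl) = K-closed true
      closed-αβ (inj₂ refl) = K-closed false
      open Interchange c proper α β K closed-αβ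
      after-interchange : ∀ {e} → inc v e ≡ true → c e ≡ nothing → partner c β (other v e) ≡ nothing →
                          K (other v e) ≡ true → Improvement c
      after-interchange {e} v∈e e-uncolored β∉u Ku =
        improvement-transport uncolored⊆ same-#uncolored
          (assign-improvement recolor-proper v∈e (is-just-false (trans (recolor-is-just e) (cong is-just e-uncolored)))
            (λ i v∈i c′i → partner-nothing α∉v i v∈i (trans (sym (unchanged-outside Kv i v∈i)) c′i))
            (α-missing-inside Ku β∉u))
        where
        uncolored⊆ : Uncolored⊆ c′ c
        uncolored⊆ i c′i = is-just-false (trans (sym (recolor-is-just i)) (cong is-just c′i))
        same-#uncolored : #uncolored c′ ≡ #uncolored c
        same-#uncolored = sum-cong-≗ (λ i → cong (boolToℕ ∘ not) (recolor-is-just i))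

  Balanced : Coloring → Set
  Balanced c = ∀ v → uncolored-deg c v ≤ colored-deg c v

  module Balancing (deg≤D : ∀ x → count (inc x) ≤ D) where

    uncolored-deg≤#missing : ∀ c x → uncolored-deg c x ≤ count (λ γ → missing c γ x)
    uncolored-deg≤#missing c x = +-cancelʳ-≤ (colored-deg c x) _ _ (begin
      uncolored-deg c x + colored-deg c x   ≡⟨ +-comm (uncolored-deg c x) _ ⟩
      colored-deg c x + uncolored-deg c x   ≡⟨ deg-split c x ⟩
      count (inc x)                         ≤⟨ deg≤D x ⟩
      D                                     ≡⟨ #missing+#used c x ⟨
      #missing + count (λ γ → used c γ x)   ≤⟨ +-monoʳ-≤ #missing (#used≤colored-deg c x) ⟩
      #missing + colored-deg c x            ∎)
      where
      open ≤-Reasoning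
      #missing = count (λ γ → missing c γ x)

    module AtUnbalanced (c : Coloring) (proper : Proper c) (v : Fin n)
                        (unbalanced : colored-deg c v < uncolored-deg c v) where

      U : Fin (length E) → Bool
      U i = inc v i ∧ is-nothing (c i)

      U-inc : ∀ {i} → U i ≡ true → inc v i ≡ true
      U-inc = proj₁ ∘ ∧-true⁻

      U-uncolored : ∀ {i} → U i ≡ true → c i ≡ nothing
      U-uncolored {i} Ui with c i | proj₂ (∧-true⁻ {inc v i} Ui)
      ... | nothing | _ = refl

      free-colour : ∃ λ α → missing c α v ≡ true
      free-colour = count-witness _ (+-cancelʳ-≤ (count (λ γ → used c γ v)) 1 _ (begin
        1 + count (λ γ → used c γ v)    ≤⟨ +-monoʳ-≤ 1 (#used≤colored-deg c v) ⟩
        suc (colored-deg c v)           ≤⟨ <-≤-trans unbalanced (m≤n+m _ (colored-deg c v)) ⟩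
        colored-deg c v + uncolored-deg c v  ≡⟨ deg-split c v ⟩
        count (inc v)                   ≤⟨ deg≤D v ⟩
        D                               ≡⟨ #missing+#used c v ⟨
        count (λ γ → missing c γ v) + count (λ γ → used c γ v) ∎))
        where open ≤-Reasoning

      α : Fin D
      α = proj₁ free-colour

      DirectEdge : Set
      DirectEdge = ∃ λ e → ∃ λ β → U e ≡ true × missing c β v ≡ true × missing c β (other v e) ≡ true

      direct-edge? : Dec DirectEdge
      direct-edge? = any? λ e → any? λ β →
        (U e B.≟ true) ×-dec (missing c β v B.≟ true) ×-dec (missing c β (other v e) B.≟ true)

      KempePair : Set
      KempePair = ∃ λ e₁ → ∃ λ e₂ → ∃ λ β → U e₁ ≡ true × U e₂ ≡ true × other v e₁ ≢ other v e₂ ×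
                    missing c β (other v e₁) ≡ true × missing c β (other v e₂) ≡ true

      kempe-pair? : Dec KempePair
      kempe-pair? = any? λ e₁ → any? λ e₂ → any? λ β →
        (U e₁ B.≟ true) ×-dec (U e₂ B.≟ true) ×-dec ¬? (other v e₁ ≟ other v e₂) ×-dec
        (missing c β (other v e₁) B.≟ true) ×-dec (missing c β (other v e₂) B.≟ true)

      multiplicity : Fin n → ℕ
      multiplicity u = count (λ i → U i ∧ does (other v i ≟ u))

      uncolored-deg≡∑multiplicity : uncolored-deg c v ≡ ∑[ u < n ] multiplicity u
      uncolored-deg≡∑multiplicity = trans (sum-cong-≗ (λ i → sym (count-∧-≟ (U i) (other v i))))
                                          (∑-comm (λ i u → boolToℕ (U i ∧ does (other v i ≟ u))))

      Adjacent : Fin n → Set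
      Adjacent u = ∃ λ i → (U i ∧ does (other v i ≟ u)) ≡ true

      adjacent? : ∀ u → Dec (Adjacent u)
      adjacent? u = any? (λ i → (U i ∧ does (other v i ≟ u)) B.≟ true)

      adjacent : Fin n → Bool
      adjacent u = does (adjacent? u)

      adjacent-edge : ∀ {u} → adjacent u ≡ true → ∃ λ e → U e ≡ true × other v e ≡ u
      adjacent-edge {u} adj with from-does (adjacent? u) adj
      ... | e , h = let (Ue , o) = ∧-true⁻ {U e} h in e , Ue , from-does (other v e ≟ u) o

      multiplicity≤#missing : ∀ u → multiplicity u ≤ count (λ β → adjacent u ∧ missing c β u)
      multiplicity≤#missing u = via (adjacent? u)
        where
        via : (d : Dec (Adjacent u)) → multiplicity u ≤ count (λ β → does d ∧ missing c β u)
        via (no ¬adj) = ≤-reflexive (trans (count-none (λ i h → ¬adj (i , h))) (sym (count-false D)))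
        via (yes _) = ≤-trans (count-mono uncolored-at-u) (uncolored-deg≤#missing c u)
          where
          uncolored-at-u : ∀ i → (U i ∧ does (other v i ≟ u)) ≡ true → (inc u i ∧ is-nothing (c i)) ≡ true
          uncolored-at-u i h with ∧-true⁻ {U i} h
          ... | Ui , o =
            ∧-true⁺ (subst (λ z → inc z i ≡ true) (from-does (other v i ≟ u) o) (incident-other-end v (lookup E i) (U-inc Ui)))
                                 (proj₂ (∧-true⁻ {inc v i} Ui))

      at-most-used : ¬ DirectEdge → ¬ KempePair →
                     ∀ β → count (λ u → adjacent u ∧ missing c β u) ≤ boolToℕ (used c β v)
      at-most-used ¬direct ¬kempe β with used c β v in βv
      ... | false = ≤-reflexive (count-none none)
        where
        none : ∀ u → (adjacent u ∧ missing c β u) ≢ true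
        none u h with ∧-true⁻ {adjacent u} h
        ... | adj , β∉u with adjacent-edge adj
        ...   | e , Ue , refl = ¬direct (e , β , Ue , cong not βv , β∉u)
      ... | true = count-atMostOne _ unique
        where
        unique : ∀ u u′ → (adjacent u ∧ missing c β u) ≡ true → (adjacent u′ ∧ missing c β u′) ≡ true → u ≡ u′
        unique u u′ h h′ with u ≟ u′ | ∧-true⁻ {adjacent u} h | ∧-true⁻ {adjacent u′} h′
        ... | yes u≡u′ | _ | _ = u≡u′
        ... | no u≢u′ | adj , β∉u | adj′ , β∉u′ with adjacent-edge adj | adjacent-edge adj′
        ...   | e , Ue , refl | e′ , Ue′ , refl = ⊥-elim (¬kempe (e , e′ , β , Ue , Ue′ , u≢u′ , β∉u , β∉u′))

      balanced-otherwise : ¬ DirectEdge → ¬ KempePair → uncolored-deg c v ≤ colored-deg c v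
      balanced-otherwise ¬direct ¬kempe = begin
        uncolored-deg c v                                        ≡⟨ uncolored-deg≡∑multiplicity ⟩
        ∑[ u < n ] multiplicity u                                ≤⟨ sum-mono-≤ multiplicity≤#missing ⟩
        ∑[ u < n ] ∑[ β < D ] boolToℕ (adjacent u ∧ missing c β u)
          ≡⟨ ∑-comm (λ u β → boolToℕ (adjacent u ∧ missing c β u)) ⟩
        ∑[ β < D ] count (λ u → adjacent u ∧ missing c β u)      ≤⟨ sum-mono-≤ (at-most-used ¬direct ¬kempe) ⟩
        count (λ β → used c β v)                                 ≤⟨ #used≤colored-deg c v ⟩
        colored-deg c v                                          ∎
        where open ≤-Reasoning

      improvement : Improvement c
      improvement with direct-edge? | kempe-pair?
      ... | yes (e , β , Ue , β∉v , β∉u) | _ =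
        assign-improvement proper (U-inc Ue) (U-uncolored Ue)
          (partner-nothing (missing-partner β∉v)) (partner-nothing (missing-partner β∉u))
      ... | no _ | yes (e₁ , e₂ , β , Ue₁ , Ue₂ , u₁≢u₂ , β∉u₁ , β∉u₂) =
        kempe-improvement proper (U-inc Ue₁) (U-uncolored Ue₁) (U-inc Ue₂) (U-uncolored Ue₂) u₁≢u₂
          (missing-partner (proj₂ free-colour)) (missing-partner β∉u₁) (missing-partner β∉u₂)
      ... | no ¬direct | no ¬kempe = ⊥-elim (<⇒≱ unbalanced (balanced-otherwise ¬direct ¬kempe))

    balance-acc : ∀ c → Acc _<_ (#uncolored c) → Proper c →
                  Σ Coloring λ c′ → Proper c′ × Uncolored⊆ c′ c × Balanced c′
    balance-acc c (acc rs) proper with any? (λ v → colored-deg c v <? uncolored-deg c v)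
    ... | no balanced = c , proper , (λ _ c≡nothing → c≡nothing) , (λ v → ≮⇒≥ (λ lt → balanced (v , lt)))
    ... | yes (v , unbalanced) with AtUnbalanced.improvement c proper v unbalanced
    ...   | c′ , proper′ , ⊆c , c′<c with balance-acc c′ (rs c′<c) proper′
    ...     | c″ , proper″ , ⊆c′ , balanced = c″ , proper″ , (λ i → ⊆c i ∘ ⊆c′ i) , balanced

    balance : ∀ c → Proper c → Σ Coloring λ c′ → Proper c′ × Uncolored⊆ c′ c × Balanced c′
    balance c = balance-acc c (<-wellFounded (#uncolored c))

  coloring-of-filter : ∀ q → Colorable D (filterᵇ q E) →
                       Σ Coloring λ c → Proper c × (∀ i → c i ≡ nothing → q (lookup E i) ≡ false)
  coloring-of-filter q (κ , κ-proper) = c , proper , uncolored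
    where
    c : Coloring
    c i = M.map κ (filter-index q E i)

    proper : Proper c
    proper x i j γ i≢j x∈i x∈j ci cj with filter-index q E i in fi | filter-index q E j in fj
    proper x i j γ i≢j x∈i x∈j refl cj | just k | just l =
      κ-proper k l (λ k≡l → i≢j (filter-index-injective q E i j fi (trans fj (cong just (sym k≡l)))))
        (subst₂ ShareEnd (sym (filter-index-lookup q E i fi)) (sym (filter-index-lookup q E j fj))
          (share-of-incident x (lookup E i) (lookup E j) x∈i x∈j))
        (sym (just-injective cj))

    uncolored : ∀ i → c i ≡ nothing → q (lookup E i) ≡ false
    uncolored i ci with filter-index q E i in fi
    ... | nothing = filter-index-nothing q E i fi

  colored-sublist : ∀ c → Proper c → ∃ λ es′ → es′ ⊆ E × length E ∸ length es′ ≡ #uncolored c × Colorable D es′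
  colored-sublist c proper =
    keep-labelled E c , keep-labelled-⊆ E c ,
    trans (cong (_∸ length (keep-labelled E c)) (sym (keep-labelled-length E c))) (m+n∸m≡n (length (keep-labelled E c)) _) ,
    kept-label E c , κ-proper
    where
    κ-proper : ∀ j j′ → j ≢ j′ → ShareEnd (lookup (keep-labelled E c) j) (lookup (keep-labelled E c) j′) →
               kept-label E c j ≢ kept-label E c j′
    κ-proper j j′ j≢j′ share same with incident-of-share _ _ share
    ... | x , x∈j , x∈j′ =
      proper x (kept-index E c j) (kept-index E c j′) (kept-label E c j) (j≢j′ ∘ kept-index-injective E c j j′)
        (subst (λ e → incident x e ≡ true) (kept-lookup E c j) x∈j)
        (subst (λ e → incident x e ≡ true) (kept-lookup E c j′) x∈j′)
        (kept-index-label E c j) (trans (kept-index-label E c j′) (cong just (sym same)))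

  -- Double counting of the pairs (v , e) with v ∈ s and e an uncoloured edge at v.
  #uncolored≤ : ∀ (s : Fin n → Bool) h c → (∀ i → c i ≡ nothing → ∃ λ v → s v ≡ true × inc v i ≡ true) →
                (∀ v → uncolored-deg c v ≤ h) → #uncolored c ≤ h * count s
  #uncolored≤ s h c covered bounded = begin
    #uncolored c                                               ≤⟨ sum-mono-≤ touches-s ⟩
    ∑[ i < length E ] ∑[ v < n ] boolToℕ (s v ∧ (U i ∧ inc v i))
      ≡⟨ ∑-comm (λ i v → boolToℕ (s v ∧ (U i ∧ inc v i))) ⟩
    ∑[ v < n ] count (λ i → s v ∧ (U i ∧ inc v i))             ≤⟨ sum-mono-≤ at-most-h ⟩
    ∑[ v < n ] (h * boolToℕ (s v))                            ≡⟨ *-distribˡ-sum h (boolToℕ ∘ s) ⟨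
    h * count s                                               ∎
    where
    open ≤-Reasoning
    U : Fin (length E) → Bool
    U i = is-nothing (c i)
    touches-s : ∀ i → boolToℕ (U i) ≤ count (λ v → s v ∧ (U i ∧ inc v i))
    touches-s i with c i in ci
    ... | just _ = z≤n
    ... | nothing = let (v , sv , v∈i) = covered i ci in count-positive _ v (∧-true⁺ sv v∈i)
    at-most-h : ∀ v → count (λ i → s v ∧ (U i ∧ inc v i)) ≤ h * boolToℕ (s v)
    at-most-h v with s v
    ... | false = ≤-reflexive (trans (count-false (length E)) (sym (*-zeroʳ h)))
    ... | true = ≤-trans (count-mono swap) (≤-trans (bounded v) (≤-reflexive (sym (*-identityʳ h))))
      where swap : ∀ i → (U i ∧ inc v i) ≡ true → (inc v i ∧ U i) ≡ true
            swap i h with ∧-true⁻ {U i} h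
            ... | Ui , v∈i = ∧-true⁺ v∈i Ui

  balanced-uncolored-deg : (∀ x → count (inc x) ≤ D) → ∀ {c} → Balanced c → ∀ v → uncolored-deg c v ≤ ⌊ D /2⌋
  balanced-uncolored-deg deg≤D {c} balanced v = ≤⌊/2⌋ _ D (begin
    uncolored-deg c v + uncolored-deg c v ≤⟨ +-monoˡ-≤ _ (balanced v) ⟩
    colored-deg c v + uncolored-deg c v   ≡⟨ deg-split c v ⟩
    count (inc v)                         ≤⟨ deg≤D v ⟩
    D                                     ∎)
    where open ≤-Reasoning

-- The upper bound

deletion-covers : ∀ a b → not a ∧ not b ≡ false → a ≡ true ⊎ b ≡ true
deletion-covers true _ _ = inj₁ refl
deletion-covers false true _ = inj₂ refl

module _ (G : Graph) (loopless : Loopless G) where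
  open PartialColoring (edges G) loopless (Δ G)

  deg≤Δ : ∀ x → count (inc x) ≤ Δ G
  deg≤Δ x = ≤-trans (≤-reflexive (sym (length-filter (incident x) (edges G)))) (deg≤maxDeg (edges G) x)

  colorable-after-deleting : (S : Subset (n G)) → Colorable (Δ G) (delEdges G S) →
    ∃ λ es′ → es′ ⊆ edges G × length (edges G) ∸ length es′ ≤ ⌊ Δ G /2⌋ * ∣ S ∣ × Colorable (Δ G) es′
  colorable-after-deleting S colorable-G-S with coloring-of-filter _ colorable-G-S
  ... | c₀ , proper₀ , c₀-deleted with Balancing.balance deg≤Δ c₀ proper₀
  ...   | c , proper , c⊆c₀ , balanced with colored-sublist c proper
  ...     | es′ , es′⊆E , #deleted , colorable =
    es′ , es′⊆E ,
    subst (_≤ ⌊ Δ G /2⌋ * ∣ S ∣) (sym #deleted)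
      (subst (λ k → #uncolored c ≤ ⌊ Δ G /2⌋ * k) (sym (∣∣≡count S))
        (#uncolored≤ (Vec.lookup S) ⌊ Δ G /2⌋ c covered
          (balanced-uncolored-deg deg≤Δ balanced))) ,
    colorable
    where
    covered : ∀ i → c i ≡ nothing → ∃ λ v → Vec.lookup S v ≡ true × inc v i ≡ true
    covered i ci with deletion-covers (Vec.lookup S (proj₁ (lookup (edges G) i))) _ (c₀-deleted i (c⊆c₀ i ci))
    ... | inj₁ in-S = _ , in-S , incident-fst (lookup (edges G) i)
    ... | inj₂ in-S = _ , in-S , incident-snd (lookup (edges G) i)

  resistance≤ : ∀ {r} → IsResistance G r → ∀ S → Colorable (Δ G) (delEdges G S) → r ≤ ⌊ Δ G /2⌋ * ∣ S ∣
  resistance≤ (_ , minimal) S colorable-G-S with colorable-after-deleting S colorable-G-S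
  ... | es′ , es′⊆E , few-deleted , colorable = ≤-trans (minimal es′ es′⊆E colorable) few-deleted

-- Sharpness

colorable-of-length : ∀ {n k} (es : List (Edge n)) → length es ≤ k → Colorable k es
colorable-of-length es ≤k = (λ i → inject≤ i ≤k) , λ i j i≢j _ eq → i≢j (inject≤-injective ≤k ≤k i j eq)

length≤colors : ∀ {n k} (es : List (Edge n)) → (∀ i j → ShareEnd (lookup es i) (lookup es j)) →
                Colorable k es → length es ≤ k
length≤colors es adjacent (κ , κ-proper) = injective⇒≤ injective
  where
  injective : ∀ {i j} → κ i ≡ κ j → i ≡ j
  injective {i} {j} same with i ≟ j
  ... | yes i≡j = i≡j
  ... | no i≢j = ⊥-elim (κ-proper i j i≢j (adjacent i j) same)

length-filter-++ : ∀ {A : Set} (p : A → Bool) xs ys →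
                   length (filterᵇ p (xs ++ ys)) ≡ length (filterᵇ p xs) + length (filterᵇ p ys)
length-filter-++ p xs ys = trans (cong length (filter-++ _ xs ys)) (length-++ (filterᵇ p xs))

length-filter-replicate : ∀ {A : Set} (p : A → Bool) x k → length (filterᵇ p (replicate k x)) ≡ (if p x then k else 0)
length-filter-replicate p x zero with p x
... | true = refl
... | false = refl
length-filter-replicate p x (suc k) with p x in px
... | true = cong suc (trans (length-filter-replicate p x k) (cong (λ b → if b then k else 0) px))
... | false = trans (length-filter-replicate p x k) (cong (λ b → if b then k else 0) px)

v₀ v₁ v₂ : Fin 3
v₀ = zero
v₁ = suc zero
v₂ = suc (suc zero)

e₀₁ e₀₂ e₁₂ : Edge 3
e₀₁ = v₀ , v₁
e₀₂ = v₀ , v₂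
e₁₂ = v₁ , v₂

data TriangleEdge : Edge 3 → Set where
  01-edge : TriangleEdge e₀₁
  02-edge : TriangleEdge e₀₂
  12-edge : TriangleEdge e₁₂

triangle-share : ∀ {e f} → TriangleEdge e → TriangleEdge f → ShareEnd e f
triangle-share 01-edge 01-edge = inj₁ refl
triangle-share 01-edge 02-edge = inj₁ refl
triangle-share 01-edge 12-edge = inj₂ (inj₂ (inj₁ refl))
triangle-share 02-edge 01-edge = inj₁ refl
triangle-share 02-edge 02-edge = inj₁ refl
triangle-share 02-edge 12-edge = inj₂ (inj₂ (inj₂ refl))
triangle-share 12-edge 01-edge = inj₂ (inj₁ refl)
triangle-share 12-edge 02-edge = inj₂ (inj₂ (inj₂ refl))
triangle-share 12-edge 12-edge = inj₁ refl

triangle-length≤colors : ∀ {k} (es : List (Edge 3)) → All TriangleEdge es → Colorable k es → length es ≤ k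
triangle-length≤colors es triangle =
  length≤colors es (λ i j → triangle-share (All.lookup triangle (∈-lookup i)) (All.lookup triangle (∈-lookup j)))

module FatTriangle (d′ : ℕ) where

  d h c : ℕ
  d = suc (suc d′)
  h = ⌊ d /2⌋
  c = ⌈ d /2⌉

  A B C E : List (Edge 3)
  A = replicate h e₀₁
  B = replicate h e₀₂
  C = replicate c e₁₂
  E = A ++ (B ++ C)

  G : Graph
  G = graph 3 E

  h+c≡d : h + c ≡ d
  h+c≡d = ⌊n/2⌋+⌈n/2⌉≡n d

  h+h≤d : h + h ≤ d
  h+h≤d = ≤-trans (+-monoʳ-≤ h (⌊n/2⌋≤⌈n/2⌉ d)) (≤-reflexive h+c≡d)

  C-triangle : All TriangleEdge C
  C-triangle = replicate⁺ c 12-edge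

  E-triangle : All TriangleEdge E
  E-triangle = ++⁺ (replicate⁺ h 01-edge) (++⁺ (replicate⁺ h 02-edge) C-triangle)

  loopless : Loopless G
  loopless = All.map non-loop E-triangle
    where
    non-loop : ∀ {e} → TriangleEdge e → proj₁ e ≢ proj₂ e
    non-loop 01-edge ()
    non-loop 02-edge ()
    non-loop 12-edge ()

  01∈E : e₀₁ ∈ E
  01∈E = here refl
  02∈E : e₀₂ ∈ E
  02∈E = ∈-++⁺ʳ A (here refl)
  12∈E : e₁₂ ∈ E
  12∈E = ∈-++⁺ʳ A (∈-++⁺ʳ B (here refl))

  connected : Connected G
  connected zero zero = here
  connected zero (suc zero) = step (inj₁ 01∈E) here
  connected zero (suc (suc zero)) = step (inj₁ 02∈E) here
  connected (suc zero) zero = step (inj₂ 01∈E) here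
  connected (suc zero) (suc zero) = here
  connected (suc zero) (suc (suc zero)) = step (inj₁ 12∈E) here
  connected (suc (suc zero)) zero = step (inj₂ 02∈E) here
  connected (suc (suc zero)) (suc zero) = step (inj₂ 12∈E) here
  connected (suc (suc zero)) (suc (suc zero)) = here

  deg-E : ∀ v → deg E v ≡ length (filterᵇ (incident v) A) + (length (filterᵇ (incident v) B) + length (filterᵇ (incident v) C))
  deg-E v = trans (length-filter-++ (incident v) A (B ++ C))
                  (cong (length (filterᵇ (incident v) A) +_) (length-filter-++ (incident v) B C))

  deg-v : ∀ v → deg E v ≡ (if incident v e₀₁ then h else 0) +
                           ((if incident v e₀₂ then h else 0) + (if incident v e₁₂ then c else 0))
  deg-v v = trans (deg-E v) (cong₂ _+_ (length-filter-replicate (incident v) e₀₁ h)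
                     (cong₂ _+_ (length-filter-replicate (incident v) e₀₂ h) (length-filter-replicate (incident v) e₁₂ c)))

  Δ≡d : Δ G ≡ d
  Δ≡d = begin
    deg E v₀ ⊔ (deg E v₁ ⊔ (deg E v₂ ⊔ 0))
      ≡⟨ cong₂ _⊔_ (deg-v v₀) (cong₂ (λ a b → a ⊔ (b ⊔ 0)) (deg-v v₁) (deg-v v₂)) ⟩
    (h + (h + 0)) ⊔ ((h + (0 + c)) ⊔ ((0 + (h + c)) ⊔ 0))
      ≡⟨ cong₂ (λ a b → (h + a) ⊔ (b ⊔ (h + c ⊔ 0))) (+-identityʳ h) h+c≡d ⟩
    (h + h) ⊔ (d ⊔ ((h + c) ⊔ 0))
      ≡⟨ cong (λ a → (h + h) ⊔ (d ⊔ a)) (trans (⊔-identityʳ (h + c)) h+c≡d) ⟩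
    (h + h) ⊔ (d ⊔ d)                                ≡⟨ cong ((h + h) ⊔_) (⊔-idem d) ⟩
    (h + h) ⊔ d                                      ≡⟨ m≤n⇒m⊔n≡n h+h≤d ⟩
    d                                                ∎
    where open ≡-Reasoning

  length-B++C : length (B ++ C) ≡ d
  length-B++C = trans (length-++ B) (trans (cong₂ _+_ (length-replicate h) (length-replicate c)) h+c≡d)

  length-E : length E ≡ h + d
  length-E = trans (length-++ A) (cong₂ _+_ (length-replicate h) length-B++C)

  resistance : IsResistance G h
  resistance =
    (B ++ C , ++⁺ˡ A ⊆-refl , trans (cong₂ _∸_ length-E length-B++C) (m+n∸n≡m h d) ,
     colorable-of-length (B ++ C) (≤-reflexive (trans length-B++C (sym Δ≡d)))) ,
    λ es′ es′⊆E colorable → begin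
      h                         ≡⟨ m+n∸n≡m h d ⟨
      h + d ∸ d                 ≤⟨ ∸-monoʳ-≤ (h + d) (≤-trans (triangle-length≤colors es′ (All-resp-⊆ es′⊆E E-triangle) colorable)
                                                              (≤-reflexive Δ≡d)) ⟩
      h + d ∸ length es′        ≡⟨ cong (_∸ length es′) length-E ⟨
      length E ∸ length es′     ∎
    where open ≤-Reasoning

  E-not-colorable : ¬ Colorable d E
  E-not-colorable colorable =
    <-irrefl refl (<-≤-trans (+-monoˡ-≤ d (s≤s z≤n))
                             (≤-trans (≤-reflexive (sym length-E)) (triangle-length≤colors E E-triangle colorable)))

  v₀-deleted : Subset 3
  v₀-deleted = true ∷ false ∷ false ∷ []

  kept-by : Subset 3 → Edge 3 → Bool
  kept-by S (a , b) = not (Vec.lookup S a) ∧ not (Vec.lookup S b)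

  delEdges-v₀ : delEdges G v₀-deleted ≡ C
  delEdges-v₀ = trans (filter-++ keep? A (B ++ C)) (cong₂ _++_ (filter-none keep? (replicate⁺ {x = e₀₁} h λ ()))
                  (trans (filter-++ keep? B C) (cong₂ _++_ (filter-none keep? (replicate⁺ {x = e₀₂} h λ ()))
                                                           (filter-all keep? (replicate⁺ {x = e₁₂} c tt)))))
    where keep? = T? ∘ kept-by v₀-deleted

  nothing-deleted : delEdges G (false ∷ false ∷ false ∷ []) ≡ E
  nothing-deleted = filter-all (T? ∘ kept-by (false ∷ false ∷ false ∷ [])) (All.map kept E-triangle)
    where
    kept : ∀ {e} → TriangleEdge e → T (kept-by (false ∷ false ∷ false ∷ []) e)
    kept 01-edge = tt
    kept 02-edge = tt
    kept 12-edge = tt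

  maxDeg-C : maxDeg 3 C ≡ c
  maxDeg-C = begin
    deg C v₀ ⊔ (deg C v₁ ⊔ (deg C v₂ ⊔ 0)) ≡⟨ cong₂ _⊔_ (length-filter-replicate (incident v₀) e₁₂ c)
                                               (cong₂ (λ a b → a ⊔ (b ⊔ 0)) (length-filter-replicate (incident v₁) e₁₂ c)
                                                                          (length-filter-replicate (incident v₂) e₁₂ c)) ⟩
    c ⊔ (c ⊔ 0)                            ≡⟨ cong (c ⊔_) (⊔-identityʳ c) ⟩
    c ⊔ c                                  ≡⟨ ⊔-idem c ⟩
    c                                      ∎
    where open ≡-Reasoning

  C-class1 : Class1 3 C
  C-class1 = colorable-of-length C (≤-reflexive (trans (length-replicate c) (sym maxDeg-C))) ,
             λ k colorable → ≤-trans (≤-reflexive (trans maxDeg-C (sym (length-replicate c))))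
                                     (triangle-length≤colors C C-triangle colorable)

  some-vertex-deleted : ∀ S → Colorable d (delEdges G S) → 1 ≤ ∣ S ∣
  some-vertex-deleted (true ∷ _) _ = s≤s z≤n
  some-vertex-deleted (false ∷ true ∷ _) _ = s≤s z≤n
  some-vertex-deleted (false ∷ false ∷ true ∷ []) _ = s≤s z≤n
  some-vertex-deleted (false ∷ false ∷ false ∷ []) colorable =
    ⊥-elim (E-not-colorable (subst (Colorable d) nothing-deleted colorable))

  vertex-resistance : IsRv G 1
  vertex-resistance =
    (v₀-deleted , refl , subst (Class1 3) (sym delEdges-v₀) C-class1) ,
    λ S class1 → some-vertex-deleted S (colorable-weaken (delEdges G S)
                   (≤-trans (maxDeg-filter 3 E (kept-by S)) (≤-reflexive Δ≡d)) (proj₁ class1))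

  vertex-resistance′ : IsRv' G 1
  vertex-resistance′ =
    (v₀-deleted , refl , subst (Colorable (Δ G)) (sym delEdges-v₀)
       (colorable-of-length C (≤-trans (≤-reflexive (length-replicate c))
                                       (≤-trans (m≤n+m c h) (≤-reflexive (trans h+c≡d (sym Δ≡d))))))) ,
    λ S colorable → some-vertex-deleted S (subst (λ k → Colorable k (delEdges G S)) Δ≡d colorable)

sharpness : (d : ℕ) → 2 ≤ d →
  ∃[ G ] (IsGraph G × Δ G ≡ d ×
    ∃[ r ] ∃[ rv ] ∃[ rv' ] (IsResistance G r × IsRv G rv × IsRv' G rv' ×
      1 ≤ rv × 1 ≤ rv' × r ≡ ⌊ d /2⌋ * rv × r ≡ ⌊ d /2⌋ * rv'))
sharpness (suc (suc d′)) _ =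
  G , (loopless , connected) , Δ≡d , h , 1 , 1 , resistance , vertex-resistance , vertex-resistance′ ,
  s≤s z≤n , s≤s z≤n , sym (*-identityʳ h) , sym (*-identityʳ h)
  where open FatTriangle d′
sharpness (suc zero) (s≤s ())

theorem3p2 :
  ((G : Graph) → IsGraph G → (r rv rv' : ℕ) →
    IsResistance G r → IsRv G rv → IsRv' G rv' →
    (r ≤ ⌊ Δ G /2⌋ * rv) × (r ≤ ⌊ Δ G /2⌋ * rv'))
  ×
  ((d : ℕ) → 2 ≤ d →
    ∃[ G ] (IsGraph G × Δ G ≡ d ×
      ∃[ r ] ∃[ rv ] ∃[ rv' ] (IsResistance G r × IsRv G rv × IsRv' G rv' ×
        1 ≤ rv × 1 ≤ rv' × r ≡ ⌊ d /2⌋ * rv × r ≡ ⌊ d /2⌋ * rv')))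
theorem3p2 = upper-bounds , sharpness
  where
  upper-bounds : (G : Graph) → IsGraph G → (r rv rv' : ℕ) → IsResistance G r → IsRv G rv → IsRv' G rv' →
                 (r ≤ ⌊ Δ G /2⌋ * rv) × (r ≤ ⌊ Δ G /2⌋ * rv')
  upper-bounds G (loopless , _) r rv rv' is-r ((S , ∣S∣≡rv , class1) , _) ((S′ , ∣S′∣≡rv′ , colorable) , _) =
    subst (λ k → r ≤ ⌊ Δ G /2⌋ * k) ∣S∣≡rv
      (resistance≤ G loopless is-r S (colorable-weaken (delEdges G S) (maxDeg-filter (n G) (edges G) _) (proj₁ class1))) ,
    subst (λ k → r ≤ ⌊ Δ G /2⌋ * k) ∣S′∣≡rv′ (resistance≤ G loopless is-r S′ colorable)
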